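{- (Upward derivability for the ability fragment of CCSR.) Let $\gamma$ be an elementary disjunction, $PI$ a finite index set, and for each $j\in PI$ let $A_j,B_j$ be coalitions and $\phi_j,\psi_j\in\Phi_{\mathsf{CCSR}_{AB}}$. Suppose that either $\vdash_{\mathsf{CCSR}_{AB}}\gamma$, or there is a syntactically well-arranged sequence of subsets of $PI$. Then $\vdash_{\mathsf{CCSR}_{AB}}\gamma\vee\bigvee_{j\in PI}\mathsf C(A_j,\phi_j;B_j,\psi_j)$.
   Context: Fix a nonempty finite set $Ag$ of agents and a countable set $AP$ of atoms; a coalition is a subset of $Ag$. $\Phi_{\mathsf{CCSR}_{AB}}$: $\phi::=\top\mid\bot\mid p\mid\neg p\mid(\phi\wedge\phi)\mid(\phi\vee\phi)\mid\mathsf C(A,\phi;B,\phi)$ ($p\in AP$, $A,B$ coalitions). An elementary disjunction is a disjunction of literals; the empty disjunction is $\bot$. $\vdash_{\mathsf{CCSR}_{AB}}\phi$ means $\phi$ is derivable in the system whose axioms are the propositional tautologies in $\Phi_{\mathsf{CCSR}_{AB}}$ and whose rules are: R1: from $\phi_1,\dots,\phi_n$ infer $\psi$ where $(\phi_1\wedge\dots\wedge\phi_n)\to\psi$ is a propositional tautology; R2: from $\phi$ infer $\mathsf C(A,\phi;\emptyset,\top)$; R3: from $\mathsf C(A,\phi_1\vee\phi_2;\emptyset,\top)\vee\chi$ infer $\mathsf C(A,\phi_1;\emptyset,\top)\vee\mathsf C(Ag,\phi_2;\emptyset,\top)\vee\chi$; R4: from $\mathsf C(A,\phi\wedge\psi;\emptyset,\top)\vee\chi$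 infer $\mathsf C(A,\phi;B,\psi)\vee\chi$; R5: from $(\mathsf C(A\cup B,\phi\wedge\psi;\emptyset,\top)\wedge\mathsf C(\emptyset,\phi;\emptyset,\top))\vee\chi$ infer $\mathsf C(A,\phi;B,\psi)\vee\chi$. Let $PI^{f}=\{j\in PI\mid A_j=Ag\}$ and $PI^{fs}=\{j\in PI\mid A_j\cup B_j=Ag\}$. For $P_1,P_2\subseteq PI$, $P_2$ is a syntactical expansion of $P_1$ if there is $j'\in PI\setminus P_1$ such that $\vdash_{\mathsf{CCSR}_{AB}}\bigvee_{j\in P_1}(\phi_j\wedge\psi_j)\vee\phi_{j'}$ and $P_2=P_1\cup\{j'\}$. A sequence $(P_k)_{0\le k\le\ell}$ of subsets of $PI$ ($\ell\in\mathbb N$) is syntactically well-arranged if: (1) $P_0=PI^{f}$; (2) $PI^{f}\subseteq P_k\subseteq PI^{fs}$ for every $k<\ell$; (3) $P_{k+1}$ is a syntactical expansion of $P_k$ for every $k<\ell$; (4) $\vdash_{\mathsf{CCSR}_{AB}}\bigvee_{j\in P_\ell}(\phi_j\wedge\psi_j)$. -}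

module Defs where

open import Data.Nat using (ℕ; zero; suc; _<_; _≤_)
open import Data.Bool using (Bool; true; false; _∧_; _∨_; not; if_then_else_)
import Data.Bool as B
open import Data.Fin using (Fin)
open import Data.Fin.Subset using (Subset; _∈_; _∉_; _⊆_; _∪_; ⁅_⁆)
import Data.Fin.Subset as S
open import Data.Vec using (Vec; tabulate)
open import Data.Vec.Properties using (≡-dec)
import Data.Fin.Subset.Properties as SP
open import Data.List using (List; []; _∷_; foldr; filter)
open import Data.List.Relation.Unary.All using (All)
open import Data.Product using (Σ; _×_; _,_)
open import Relation.Nullary using (does; Dec)
open import Relation.Binary.PropositionalEquality using (_≡_)

-- Agents: Ag = Fin na, with na ≥ 1 enforced by writing na = suc n.
-- Coalitions: subsets of Ag.  Atoms: AP = ℕ (countable).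
Coalition : ℕ → Set
Coalition na = Subset na

Atom : Set
Atom = ℕ

data Fm (na : ℕ) : Set where
  ⊤'  : Fm na
  ⊥'  : Fm na
  at  : Atom → Fm na
  nat : Atom → Fm na               -- ¬ p
  _∧'_ : Fm na → Fm na → Fm na
  _∨'_ : Fm na → Fm na → Fm na
  C   : Coalition na → Fm na → Coalition na → Fm na → Fm na

infixr 6 _∧'_
infixr 5 _∨'_

eval : ∀ {na} → (Atom → Bool) → (Fm na → Bool) → Fm na → Bool
eval v w ⊤' = true
eval v w ⊥' = false
eval v w (at p) = v p
eval v w (nat p) = not (v p)
eval v w (φ ∧' ψ) = eval v w φ ∧ eval v w ψ
eval v w (φ ∨' ψ) = eval v w φ ∨ eval v w ψ
eval v w (C A φ B ψ) = w (C A φ B ψ)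

Taut : ∀ {na} → Fm na → Set
Taut φ = ∀ v w → eval v w φ ≡ true

TautImp : ∀ {na} → List (Fm na) → Fm na → Set
TautImp φs ψ = ∀ v w → All (λ φ → eval v w φ ≡ true) φs → eval v w ψ ≡ true

data ⊢ {na : ℕ} : Fm na → Set where
  ax : ∀ {φ} → Taut φ → ⊢ φ
  R1 : ∀ {φs ψ} → All ⊢ φs → TautImp φs ψ → ⊢ ψ
  R2 : ∀ {A φ} → ⊢ φ → ⊢ (C A φ S.⊥ ⊤')
  R3 : ∀ {A φ₁ φ₂ χ} → ⊢ (C A (φ₁ ∨' φ₂) S.⊥ ⊤' ∨' χ)
       → ⊢ (C A φ₁ S.⊥ ⊤' ∨' C S.⊤ φ₂ S.⊥ ⊤' ∨' χ)
  R4 : ∀ {A B φ ψ χ} → ⊢ (C A (φ ∧' ψ) S.⊥ ⊤' ∨' χ) → ⊢ (C A φ B ψ ∨' χ)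
  R5 : ∀ {A B φ ψ χ} → ⊢ ((C (A ∪ B) (φ ∧' ψ) S.⊥ ⊤' ∧' C S.⊥ φ S.⊥ ⊤') ∨' χ)
       → ⊢ (C A φ B ψ ∨' χ)

data ElemDisj {na : ℕ} : Fm na → Set where
  ed⊥  : ElemDisj ⊥'
  edp  : ∀ p → ElemDisj (at p)
  ed¬p : ∀ p → ElemDisj (nat p)
  ed∨  : ∀ {γ δ} → ElemDisj γ → ElemDisj δ → ElemDisj (γ ∨' δ)

⋁ : ∀ {na} → List (Fm na) → Fm na
⋁ = foldr _∨'_ ⊥'

⋁∈ : ∀ {na m} → Subset m → (Fin m → Fm na) → Fm na
⋁∈ {m = m} P f = ⋁ (Data.List.map f (filter (λ j → j SP.∈? P) (Data.List.allFin m)))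

PIf : ∀ {na m} → (Fin m → Coalition na) → Subset m
PIf A = tabulate (λ j → does (≡-dec B._≟_ (A j) S.⊤))

PIfs : ∀ {na m} → (Fin m → Coalition na) → (Fin m → Coalition na) → Subset m
PIfs A B' = tabulate (λ j → does (≡-dec B._≟_ (A j ∪ B' j) S.⊤))

record Family (na m : ℕ) : Set where
  field
    A B : Fin m → Coalition na
    φ ψ : Fin m → Fm na

open Family public

SynExp : ∀ {na m} → Family na m → Subset m → Subset m → Set
SynExp F P₁ P₂ =
  Σ (Fin _) λ j' → (j' ∉ P₁)
    × ⊢ (⋁∈ P₁ (λ j → φ F j ∧' ψ F j) ∨' φ F j')
    × (P₂ ≡ P₁ ∪ ⁅ j' ⁆)

-- (P_k)_{0 ≤ k ≤ ℓ} is syntactically well-arranged (only P 0 … P ℓ matter)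
WellArranged : ∀ {na m} → Family na m → (ℓ : ℕ) → (ℕ → Subset m) → Set
WellArranged F ℓ P =
    (P 0 ≡ PIf (A F))
  × (∀ k → k < ℓ → PIf (A F) ⊆ P k × P k ⊆ PIfs (A F) (B F))
  × (∀ k → k < ℓ → SynExp F (P k) (P (suc k)))
  × ⊢ (⋁∈ (P ℓ) (λ j → φ F j ∧' ψ F j))

HasWellArranged : ∀ {na m} → Family na m → Set
HasWellArranged {m = m} F = Σ ℕ λ ℓ → Σ (ℕ → Subset m) λ P → WellArranged F ℓ P

{-# OPTIONS --safe #-}
-- Let θⱼ = φⱼ ∧ ψⱼ, write C(A, χ) for C(A, χ; ∅, ⊤), and let ⋁C be the disjunction of
-- all C(Aⱼ, φⱼ; Bⱼ, ψⱼ). R2 followed by iterated R3 turns ⊢ χ₀ ∨ … ∨ χₙ into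
-- ⊢ C(A, χ₀) ∨ C(Ag, χ₁) ∨ … ∨ C(Ag, χₙ) for any A. Call P pending if
-- ⊢ ⋁_{j∈P} C(Ag, θⱼ) ∨ ⋁C, and descend the well-arranged sequence. If ℓ = 0, splitting
-- ⊢ ⋁_{P₀} θ makes P₀ pending. Otherwise Pℓ = Pℓ₋₁ ∪ {j}; splitting ⊢ ⋁_{Pℓ} θ with A = Aⱼ
-- at θⱼ and applying R4 makes Pℓ₋₁ pending. If Pₖ₊₁ = Pₖ ∪ {j} is pending and Aⱼ ∪ Bⱼ = Ag,
-- splitting ⊢ ⋁_{Pₖ} θ ∨ φⱼ with A = ∅ at φⱼ puts C(∅, φⱼ) next to the pending C(Ag, θⱼ),
-- and R5 replaces the pair by C(Aⱼ, φⱼ; Bⱼ, ψⱼ), so Pₖ is pending. Finally P₀ = PIᶠ, and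
-- for j ∈ PIᶠ R4 turns C(Ag, θⱼ) = C(Aⱼ, θⱼ) into C(Aⱼ, φⱼ; Bⱼ, ψⱼ).
module Submission where

open import Defs
open import Data.Nat using (ℕ; suc; _<_; z<s; s<s)
open import Data.Fin using (Fin)
open import Data.Fin.Subset using (Subset; ⊤; _∈_; _⊆_; _∪_; ⁅_⁆) renaming (⊥ to ∅)
open import Data.Fin.Subset.Properties using (_∈?_; ∈⊤; x∈p∪q⁺; x∈p∪q⁻; x∈⁅x⁆; x∈⁅y⁆⇒x≡y)
open import Data.Bool using (Bool; T; _∧_; _≟_)
open import Data.Bool.Properties using (T-≡; T-∨; T-∧)
open import Data.List using (List; []; _∷_; map; filter; allFin)
open import Data.List.Properties using (map-∘)
open import Data.List.Relation.Unary.All as All using (All; []; _∷_)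
open import Data.List.Relation.Unary.All.Properties using (all-filter)
open import Data.List.Relation.Unary.Any using (Any; here; there)
open import Data.List.Relation.Unary.Any.Properties using (map⁺; map⁻)
open import Data.List.Membership.Propositional using (find; lose)
open import Data.List.Membership.Propositional.Properties using (∈-filter⁺; ∈-filter⁻; ∈-allFin)
open import Data.Vec using (tabulate)
open import Data.Vec.Properties using (≡-dec; lookup∘tabulate; []=⇒lookup)
open import Data.Product as Product using (∃; _×_; _,_; proj₂)
open import Data.Sum as Sum using (_⊎_; inj₁; inj₂; [_,_]′)
open import Function using (_∘_; id; Equivalence)
open import Relation.Nullary.Decidable using (does; yes; no)
open import Relation.Unary using (Decidable)
open import Relation.Binary.PropositionalEquality using (_≡_; refl; sym; trans; cong₂; subst)

open Equivalence using (to; from)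

private
  variable
    na : ℕ
    α β γ : Fm na

-- A record rather than T ∘ eval, so that Sat v w α determines α during unification.
record Sat (v : Atom → Bool) (w : Fm na → Bool) (α : Fm na) : Set where
  constructor sat
  field unsat : T (eval v w α)

infix 4 _⇛_
_⇛_ : Fm na → Fm na → Set
α ⇛ β = ∀ {v w} → Sat v w α → Sat v w β

⊢-⇛ : ⊢ α → α ⇛ β → ⊢ β
⊢-⇛ ⊢α α⇛β = R1 (⊢α ∷ []) λ { v w (tα ∷ []) → to T-≡ (Sat.unsat (α⇛β (sat (from T-≡ tα)))) }

⊢-∧ : ⊢ α → ⊢ β → ⊢ (α ∧' β)
⊢-∧ ⊢α ⊢β = R1 (⊢α ∷ ⊢β ∷ []) λ { v w (tα ∷ tβ ∷ []) → cong₂ _∧_ tα tβ }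

module _ {v : Atom → Bool} {w : Fm na → Bool} where

  inl : Sat v w α → Sat v w (α ∨' β)
  inl (sat t) = sat (from T-∨ (inj₁ t))

  inr : Sat v w β → Sat v w (α ∨' β)
  inr {α = α} (sat t) = sat (from (T-∨ {eval v w α}) (inj₂ t))

  ∨-elim : Sat v w (α ∨' β) → Sat v w α ⊎ Sat v w β
  ∨-elim {α = α} (sat t) = Sum.map sat sat (to (T-∨ {eval v w α}) t)

  ∧-intro : Sat v w α → Sat v w β → Sat v w (α ∧' β)
  ∧-intro (sat tα) (sat tβ) = sat (from T-∧ (tα , tβ))

  ∧-elim : Sat v w (α ∧' β) → Sat v w α × Sat v w β
  ∧-elim {α = α} (sat t) = Product.map sat sat (to (T-∧ {eval v w α}) t)

∨-case : α ⇛ γ → β ⇛ γ → α ∨' β ⇛ γ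
∨-case f g = [ f , g ]′ ∘ ∨-elim

∨-monoʳ : β ⇛ γ → α ∨' β ⇛ α ∨' γ
∨-monoʳ f = ∨-case inl (inr ∘ f)

∨-identityˡ : ⊥' ∨' α ⇛ α
∨-identityˡ = ∨-case (λ { (sat ()) }) id

∨-identityʳ : α ∨' ⊥' ⇛ α
∨-identityʳ = ∨-case id (λ { (sat ()) })

∨-comm : α ∨' β ⇛ β ∨' α
∨-comm = ∨-case inr inl

∨-assoc : (α ∨' β) ∨' γ ⇛ α ∨' (β ∨' γ)
∨-assoc = ∨-case (∨-case inl (inr ∘ inl)) (inr ∘ inr)

∨-left-comm : α ∨' (β ∨' γ) ⇛ β ∨' (α ∨' γ)
∨-left-comm = ∨-case (inr ∘ inl) (∨-monoʳ inr)

∧-∨-distribʳ : (α ∨' γ) ∧' (β ∨' γ) ⇛ (α ∧' β) ∨' γ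
∧-∨-distribʳ s with ∧-elim s
... | sαγ , sβγ with ∨-elim sαγ | ∨-elim sβγ
... | inj₁ sα | inj₁ sβ = inl (∧-intro sα sβ)
... | inj₂ sγ | _       = inr sγ
... | _       | inj₂ sγ = inr sγ

⊢-∧-∨ : ⊢ (α ∨' γ) → ⊢ (β ∨' γ) → ⊢ ((α ∧' β) ∨' γ)
⊢-∧-∨ ⊢αγ ⊢βγ = ⊢-⇛ (⊢-∧ ⊢αγ ⊢βγ) ∧-∨-distribʳ

members : ∀ {m} → Subset m → List (Fin m)
members P = filter (_∈? P) (allFin _)

module _ {v : Atom → Bool} {w : Fm na → Bool} where

  sat-⋁⁺ : ∀ {αs} → Any (Sat v w) αs → Sat v w (⋁ αs)
  sat-⋁⁺ (here s)  = inl s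
  sat-⋁⁺ (there a) = inr (sat-⋁⁺ a)

  sat-⋁⁻ : ∀ αs → Sat v w (⋁ αs) → Any (Sat v w) αs
  sat-⋁⁻ (α ∷ αs) s = [ here , there ∘ sat-⋁⁻ αs ]′ (∨-elim s)

  sat-⋁∈⁺ : ∀ {m} {P : Subset m} {f : Fin m → Fm na} {j} → j ∈ P → Sat v w (f j) → Sat v w (⋁∈ P f)
  sat-⋁∈⁺ {P = P} {j = j} j∈P s = sat-⋁⁺ (map⁺ (lose (∈-filter⁺ (_∈? P) (∈-allFin j) j∈P) s))

  sat-⋁∈⁻ : ∀ {m} {P : Subset m} {f : Fin m → Fm na} → Sat v w (⋁∈ P f) → ∃ λ j → j ∈ P × Sat v w (f j)
  sat-⋁∈⁻ {P = P} {f} s with find (map⁻ (sat-⋁⁻ (map f (members P)) s))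
  ... | j , j∈members , sj = j , proj₂ (∈-filter⁻ (_∈? P) {xs = allFin _} j∈members) , sj

⋁∈-∪-⁅⁆ : ∀ {m} (P : Subset m) (f : Fin m → Fm na) j → ⋁∈ (P ∪ ⁅ j ⁆) f ⇛ f j ∨' ⋁∈ P f
⋁∈-∪-⁅⁆ P f j s with sat-⋁∈⁻ s
... | i , i∈P∪j , si with x∈p∪q⁻ P ⁅ j ⁆ i∈P∪j
...   | inj₁ i∈P  = inr (sat-⋁∈⁺ i∈P si)
...   | inj₂ i∈⁅j⁆ rewrite x∈⁅y⁆⇒x≡y j i∈⁅j⁆ = inl si

C₀ : Coalition na → Fm na → Fm na
C₀ A α = C A α ∅ ⊤'

-- ⋁ without the trailing ⊥', which R3 could never split off.
⋁⁺ : Fm na → List (Fm na) → Fm na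
⋁⁺ α []       = α
⋁⁺ α (β ∷ βs) = α ∨' ⋁⁺ β βs

∨-⋁⇛⋁⁺ : ∀ (α : Fm na) βs → α ∨' ⋁ βs ⇛ ⋁⁺ α βs
∨-⋁⇛⋁⁺ α []       = ∨-identityʳ
∨-⋁⇛⋁⁺ α (β ∷ βs) = ∨-monoʳ (∨-⋁⇛⋁⁺ β βs)

⊢-R3⋆ : ∀ (A : Coalition na) α βs γ → ⊢ (C₀ A (⋁⁺ α βs) ∨' γ)
      → ⊢ (C₀ A α ∨' (⋁ (map (C₀ ⊤) βs) ∨' γ))
⊢-R3⋆ A α []       γ ⊢C = ⊢-⇛ ⊢C (∨-monoʳ inr)
⊢-R3⋆ A α (β ∷ βs) γ ⊢C =
  ⊢-⇛ (⊢-R3⋆ ⊤ β βs (C₀ A α ∨' γ) (⊢-⇛ (R3 ⊢C) ∨-left-comm)) regroup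
  where
  regroup : C₀ ⊤ β ∨' (⋁ (map (C₀ ⊤) βs) ∨' (C₀ A α ∨' γ))
          ⇛ C₀ A α ∨' ((C₀ ⊤ β ∨' ⋁ (map (C₀ ⊤) βs)) ∨' γ)
  regroup = ∨-case (inr ∘ inl ∘ inl) (∨-case (inr ∘ inl ∘ inr) (∨-monoʳ inr))

⊢-C₀-split : ∀ (A : Coalition na) α βs → ⊢ (α ∨' ⋁ βs) → ⊢ (C₀ A α ∨' ⋁ (map (C₀ ⊤) βs))
⊢-C₀-split A α βs ⊢α∨βs =
  ⊢-⇛ (⊢-R3⋆ A α βs ⊥' (⊢-⇛ (R2 (⊢-⇛ ⊢α∨βs (∨-⋁⇛⋁⁺ α βs))) inl)) (∨-monoʳ ∨-identityʳ)

⊢-C₀-⋁ : ∀ (αs : List (Fm na)) → ⊢ (⋁ αs) → ⊢ (⋁ (map (C₀ ⊤) αs))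
⊢-C₀-⋁ []       ⊢⊥ = ⊢⊥
⊢-C₀-⋁ (α ∷ αs) ⊢⋁ = ⊢-C₀-split ⊤ α αs ⊢⋁

⊢-C₀-split-⋁∈ : ∀ {m} (A : Coalition na) α P (f : Fin m → Fm na)
              → ⊢ (α ∨' ⋁∈ P f) → ⊢ (C₀ A α ∨' ⋁∈ P (C₀ ⊤ ∘ f))
⊢-C₀-split-⋁∈ A α P f ⊢α∨⋁ =
  subst (λ βs → ⊢ (C₀ A α ∨' ⋁ βs)) (sym (map-∘ (members P)))
        (⊢-C₀-split A α (map f (members P)) ⊢α∨⋁)

⊢-C₀-⋁∈ : ∀ {m} P (f : Fin m → Fm na) → ⊢ (⋁∈ P f) → ⊢ (⋁∈ P (C₀ ⊤ ∘ f))
⊢-C₀-⋁∈ P f ⊢⋁ = subst (⊢ ∘ ⋁) (sym (map-∘ (members P))) (⊢-C₀-⋁ (map f (members P)) ⊢⋁)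

∈-tabulate-does : ∀ {m} {Q : Fin m → Set} (Q? : Decidable Q) {j} → j ∈ tabulate (does ∘ Q?) → Q j
∈-tabulate-does Q? {j} j∈ with Q? j | trans (sym (lookup∘tabulate (does ∘ Q?) j)) ([]=⇒lookup j∈)
... | yes q | _  = q
... | no _  | ()

∈-PIf⇒ : ∀ {m} (A : Fin m → Coalition na) {j} → j ∈ PIf A → A j ≡ ⊤
∈-PIf⇒ A = ∈-tabulate-does (λ j → ≡-dec _≟_ (A j) ⊤)

∈-PIfs⇒ : ∀ {m} (A B : Fin m → Coalition na) {j} → j ∈ PIfs A B → A j ∪ B j ≡ ⊤
∈-PIfs⇒ A B = ∈-tabulate-does (λ j → ≡-dec _≟_ (A j ∪ B j) ⊤)

module _ {m} (F : Family na m) where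

  θ : Fin m → Fm na
  θ j = φ F j ∧' ψ F j

  Cᶠ : Fin m → Fm na
  Cᶠ j = C (A F j) (φ F j) (B F j) (ψ F j)

  ⋁C : Fm na
  ⋁C = ⋁∈ ⊤ Cᶠ

  Pending : Subset m → Set
  Pending P = ⊢ (⋁∈ P (C₀ ⊤ ∘ θ) ∨' ⋁C)

  Cᶠ-absorb : ∀ j → Cᶠ j ∨' (α ∨' ⋁C) ⇛ α ∨' ⋁C
  Cᶠ-absorb j = ∨-case (inr ∘ sat-⋁∈⁺ {f = Cᶠ} ∈⊤) id

  ⊢-R4-absorb : ∀ j → ⊢ (C₀ (A F j) (θ j) ∨' (α ∨' ⋁C)) → ⊢ (α ∨' ⋁C)
  ⊢-R4-absorb j ⊢C₀ = ⊢-⇛ (R4 ⊢C₀) (Cᶠ-absorb j)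

  lastExpansion⇒pending : ∀ {P Q} → SynExp F P Q → ⊢ (⋁∈ Q θ) → Pending P
  lastExpansion⇒pending {P} (j , _ , _ , refl) ⊢⋁θ =
    ⊢-R4-absorb j (⊢-⇛ (⊢-C₀-split-⋁∈ (A F j) (θ j) P θ (⊢-⇛ ⊢⋁θ (⋁∈-∪-⁅⁆ P θ j))) (∨-monoʳ inl))

  pending-shrink : ∀ {P Q} → SynExp F P Q → Q ⊆ PIfs (A F) (B F) → Pending Q → Pending P
  pending-shrink {P} (j , _ , ⊢⋁θ∨φ , refl) Q⊆PIfs pendingQ =
    ⊢-⇛ (R5 (⊢-∧-∨ ⊢Cθ ⊢C∅φ)) (Cᶠ-absorb j)
    where
    Aj∪Bj≡Ag : A F j ∪ B F j ≡ ⊤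
    Aj∪Bj≡Ag = ∈-PIfs⇒ (A F) (B F) (Q⊆PIfs (x∈p∪q⁺ (inj₂ (x∈⁅x⁆ j))))
    ⊢Cθ : ⊢ (C₀ (A F j ∪ B F j) (θ j) ∨' (⋁∈ P (C₀ ⊤ ∘ θ) ∨' ⋁C))
    ⊢Cθ rewrite Aj∪Bj≡Ag = ⊢-⇛ pendingQ (∨-case (∨-monoʳ inl ∘ ⋁∈-∪-⁅⁆ P (C₀ ⊤ ∘ θ) j) (inr ∘ inr))
    ⊢C∅φ : ⊢ (C₀ ∅ (φ F j) ∨' (⋁∈ P (C₀ ⊤ ∘ θ) ∨' ⋁C))
    ⊢C∅φ = ⊢-⇛ (⊢-C₀-split-⋁∈ ∅ (φ F j) P θ (⊢-⇛ ⊢⋁θ∨φ ∨-comm)) (∨-monoʳ inl)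

  ⊢-R4-absorb-all : ∀ js → All (λ j → A F j ≡ ⊤) js → ⊢ (⋁ (map (C₀ ⊤ ∘ θ) js) ∨' ⋁C) → ⊢ ⋁C
  ⊢-R4-absorb-all []       []             ⊢⋁C = ⊢-⇛ ⊢⋁C ∨-identityˡ
  ⊢-R4-absorb-all (j ∷ js) (Aj≡Ag ∷ Ags) ⊢⋁ =
    ⊢-R4-absorb-all js Ags (⊢-R4-absorb j ⊢C₀Aj)
    where
    ⊢C₀Aj : ⊢ (C₀ (A F j) (θ j) ∨' (⋁ (map (C₀ ⊤ ∘ θ) js) ∨' ⋁C))
    ⊢C₀Aj rewrite Aj≡Ag = ⊢-⇛ ⊢⋁ ∨-assoc

  pending-PIf⇒⊢⋁C : Pending (PIf (A F)) → ⊢ ⋁C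
  pending-PIf⇒⊢⋁C = ⊢-R4-absorb-all _ (All.map (∈-PIf⇒ (A F)) (all-filter _ (allFin m)))

  descent⇒pending : ∀ ℓ (P : ℕ → Subset m)
    → (∀ k → k < ℓ → P k ⊆ PIfs (A F) (B F))
    → (∀ k → k < ℓ → SynExp F (P k) (P (suc k)))
    → ⊢ (⋁∈ (P ℓ) θ)
    → Pending (P 0)
  descent⇒pending 0             P _      _   ⊢⋁θ = ⊢-⇛ (⊢-C₀-⋁∈ (P 0) θ ⊢⋁θ) inl
  descent⇒pending 1             P _      exp ⊢⋁θ = lastExpansion⇒pending (exp 0 z<s) ⊢⋁θ
  descent⇒pending (suc (suc ℓ)) P ⊆PIfs exp ⊢⋁θ =
    pending-shrink (exp 0 z<s) (⊆PIfs 1 (s<s z<s))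
      (descent⇒pending (suc ℓ) (P ∘ suc) (λ k → ⊆PIfs (suc k) ∘ s<s) (λ k → exp (suc k) ∘ s<s) ⊢⋁θ)

  wellArranged⇒⊢⋁C : HasWellArranged F → ⊢ ⋁C
  wellArranged⇒⊢⋁C (ℓ , P , P0≡PIf , bounds , exp , ⊢⋁θ) =
    pending-PIf⇒⊢⋁C (subst Pending P0≡PIf (descent⇒pending ℓ P (λ k → proj₂ ∘ bounds k) exp ⊢⋁θ))

mainTheorem18 : (n m : ℕ) (γ : Fm (suc n)) → ElemDisj γ → (F : Family (suc n) m)
    → (⊢ γ ⊎ HasWellArranged F)
    → ⊢ (γ ∨' ⋁∈ ⊤ (λ j → C (A F j) (φ F j) (B F j) (ψ F j)))
mainTheorem18 n m γ _ F (inj₁ ⊢γ) = ⊢-⇛ ⊢γ inl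
mainTheorem18 n m γ _ F (inj₂ wa) = ⊢-⇛ (wellArranged⇒⊢⋁C F wa) inr
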